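{- In the theory $\mathsf{TC}_1(\mathtt b)$, the translation $\gamma$ described in the context supports an interpretation of the theory $\mathsf{UTC}_1$; i.e. for every sentence $\psi$, if $\mathsf{UTC}_1\vdash\psi$ then $\mathsf{TC}_1(\mathtt b)\vdash\psi^\gamma$.
   Context: $\mathsf{TC}_1$ is the one-sorted theory in the language with a constant $\varnothing$ and a binary function $*$, axiomatised by: $\varnothing*x=x\wedge x*\varnothing=x$; $x*y=\varnothing\to(x=\varnothing\wedge y=\varnothing)$; $(x*y)*z=x*(y*z)$; and the Editors Principle $x*y=u*v\to\exists w\,((x*w=u\wedge y=w*v)\vee(x=u*w\wedge w*y=v))$. An atom is an $a\neq\varnothing$ such that for all $x,y$, $x*y=a$ implies $x=\varnothing$ or $y=\varnothing$. $\mathsf{TC}_1(\mathtt b)$ is $\mathsf{TC}_1$ with an extra constant $\mathtt b$ and the axiom that $\mathtt b$ is an atom. Write $x\preceq y$ for $\exists u\exists v\,y=(u*x)*v$ and $x\preceq_{\mathsf{ini}}y$ for $\exists v\,y=x*v$. $\mathsf{UTC}_1$ is a two-sorted theory with object sort $\mathfrak o$ and string sort $\mathfrak s$, a constant $\oslash$ of sort $\mathfrak s$, a function $[\cdot]$ from $\mathfrak o$ to $\mathfrak s$ and a binary function $\star$ on $\mathfrak s$, axiomatised by: $\oslash\star\alpha=\alpha\wedge\alpha\star\oslash=\alpha$; $\alpha\star\beta=\oslash\to(\alpha=\oslash\wedge\beta=\oslash)$; $(\alpha\star\beta)\star\gamma=\alpha\star(\beta\star\gamma)$; $[x]$ is an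 atom (w.r.t. $\star,\oslash$); $[x]=[y]\to x=y$; and $\alpha\star\beta=\gamma\star\delta\to\exists\eta\,((\alpha\star\eta=\gamma\wedge\beta=\eta\star\delta)\vee(\alpha=\gamma\star\eta\wedge\eta\star\beta=\delta))$. The translation $\gamma$: the object domain is $\{x: x=\varnothing\vee\mathtt b\not\preceq x\}$; the string domain is $\{x: x=\varnothing\vee\mathtt b\preceq_{\mathsf{ini}}x\}$; $\oslash\mapsto\varnothing$; $[x]\mapsto\mathtt b*x$; $\star\mapsto *$; both equalities are translated as equality. -}

module Defs where

open import Data.List using (List; []; _∷_; map)
open import Data.Unit using (⊤; tt)
open import Data.Product using (_×_; _,_)

record Signature : Set₁ where
  field
    Sort : Set
    Fun  : Set
    dom  : Fun → List Sort
    cod  : Fun → Sort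

module Syntax (Σ : Signature) where
  open Signature Σ

  Ctx : Set
  Ctx = List Sort

  infix 4 _∋_
  data _∋_ : Ctx → Sort → Set where
    here  : ∀ {Γ s} → (s ∷ Γ) ∋ s
    there : ∀ {Γ s t} → Γ ∋ s → (t ∷ Γ) ∋ s

  mutual
    data Term (Γ : Ctx) : Sort → Set where
      var : ∀ {s} → Γ ∋ s → Term Γ s
      app : (f : Fun) → Terms Γ (dom f) → Term Γ (cod f)

    data Terms (Γ : Ctx) : List Sort → Set where
      []  : Terms Γ []
      _∷_ : ∀ {s ss} → Term Γ s → Terms Γ ss → Terms Γ (s ∷ ss)

  infixr 1 _⇒_
  infix 4 _≐_
  data Formula (Γ : Ctx) : Set where
    _≐_ : ∀ {s} → Term Γ s → Term Γ s → Formula Γ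
    ⊥'  : Formula Γ
    _⇒_ : Formula Γ → Formula Γ → Formula Γ
    all : (s : Sort) → Formula (s ∷ Γ) → Formula Γ

  Sentence : Set
  Sentence = Formula []

  ¬' : ∀ {Γ} → Formula Γ → Formula Γ
  ¬' φ = φ ⇒ ⊥'

  infixr 2 _∧'_
  infixr 2 _∨'_
  _∨'_ : ∀ {Γ} → Formula Γ → Formula Γ → Formula Γ
  φ ∨' ψ = ¬' φ ⇒ ψ

  _∧'_ : ∀ {Γ} → Formula Γ → Formula Γ → Formula Γ
  φ ∧' ψ = ¬' (φ ⇒ ¬' ψ)

  ex : ∀ {Γ} (s : Sort) → Formula (s ∷ Γ) → Formula Γ
  ex s φ = ¬' (all s (¬' φ))

  Ren : Ctx → Ctx → Set
  Ren Γ Δ = ∀ {s} → Γ ∋ s → Δ ∋ s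

  liftR : ∀ {Γ Δ t} → Ren Γ Δ → Ren (t ∷ Γ) (t ∷ Δ)
  liftR ρ here      = here
  liftR ρ (there x) = there (ρ x)

  mutual
    renT : ∀ {Γ Δ s} → Ren Γ Δ → Term Γ s → Term Δ s
    renT ρ (var x)    = var (ρ x)
    renT ρ (app f ts) = app f (renTs ρ ts)

    renTs : ∀ {Γ Δ ss} → Ren Γ Δ → Terms Γ ss → Terms Δ ss
    renTs ρ []       = []
    renTs ρ (t ∷ ts) = renT ρ t ∷ renTs ρ ts

  renF : ∀ {Γ Δ} → Ren Γ Δ → Formula Γ → Formula Δ
  renF ρ (t ≐ u)   = renT ρ t ≐ renT ρ u
  renF ρ ⊥'        = ⊥'
  renF ρ (φ ⇒ ψ)   = renF ρ φ ⇒ renF ρ ψ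
  renF ρ (all s φ) = all s (renF (liftR ρ) φ)

  wkT : ∀ {Γ s t} → Term Γ s → Term (t ∷ Γ) s
  wkT = renT there

  wkF : ∀ {Γ t} → Formula Γ → Formula (t ∷ Γ)
  wkF = renF there

  emptyRen : ∀ {Γ} → Ren [] Γ
  emptyRen ()

  closedF : ∀ {Γ} → Sentence → Formula Γ
  closedF = renF emptyRen

  Sub : Ctx → Ctx → Set
  Sub Γ Δ = ∀ {s} → Γ ∋ s → Term Δ s

  liftS : ∀ {Γ Δ t} → Sub Γ Δ → Sub (t ∷ Γ) (t ∷ Δ)
  liftS σ here      = var here
  liftS σ (there x) = wkT (σ x)

  mutual
    subT : ∀ {Γ Δ s} → Sub Γ Δ → Term Γ s → Term Δ s
    subT σ (var x)    = σ x
    subT σ (app f ts) = app f (subTs σ ts)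

    subTs : ∀ {Γ Δ ss} → Sub Γ Δ → Terms Γ ss → Terms Δ ss
    subTs σ []       = []
    subTs σ (t ∷ ts) = subT σ t ∷ subTs σ ts

  subF : ∀ {Γ Δ} → Sub Γ Δ → Formula Γ → Formula Δ
  subF σ (t ≐ u)   = subT σ t ≐ subT σ u
  subF σ ⊥'        = ⊥'
  subF σ (φ ⇒ ψ)   = subF σ φ ⇒ subF σ ψ
  subF σ (all s φ) = all s (subF (liftS σ) φ)

  single : ∀ {Γ s} → Term Γ s → Sub (s ∷ Γ) Γ
  single t here      = t
  single t (there x) = var x

  _[_] : ∀ {Γ s} → Formula (s ∷ Γ) → Term Γ s → Formula Γ
  φ [ t ] = subF (single t) φ

  Theory : Set₁
  Theory = Sentence → Set

  infix 0 _∣_⊢_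
  infix 4 _∈H_
  data _∈H_ {Γ : Ctx} (φ : Formula Γ) : List (Formula Γ) → Set where
    here  : ∀ {Δ} → φ ∈H (φ ∷ Δ)
    there : ∀ {ψ Δ} → φ ∈H Δ → φ ∈H (ψ ∷ Δ)

  -- Classical natural deduction for many-sorted FOL with equality,
  -- with the standard assumption that every sort is nonempty
  -- (rule `nonempty`: a variable not occurring in the conclusion may be discharged).
  data _∣_⊢_ (T : Theory) {Γ : Ctx} : List (Formula Γ) → Formula Γ → Set where
    axiom    : ∀ {Δ φ} → T φ → T ∣ Δ ⊢ closedF φ
    hyp      : ∀ {Δ φ} → φ ∈H Δ → T ∣ Δ ⊢ φ
    ⇒I       : ∀ {Δ φ ψ} → T ∣ φ ∷ Δ ⊢ ψ → T ∣ Δ ⊢ φ ⇒ ψ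
    ⇒E       : ∀ {Δ φ ψ} → T ∣ Δ ⊢ φ ⇒ ψ → T ∣ Δ ⊢ φ → T ∣ Δ ⊢ ψ
    raa      : ∀ {Δ φ} → T ∣ ¬' φ ∷ Δ ⊢ ⊥' → T ∣ Δ ⊢ φ
    ∀I       : ∀ {Δ s φ} → T ∣ map wkF Δ ⊢ φ → T ∣ Δ ⊢ all s φ
    ∀E       : ∀ {Δ s φ} → T ∣ Δ ⊢ all s φ → (t : Term Γ s) → T ∣ Δ ⊢ φ [ t ]
    ≐refl    : ∀ {Δ s} (t : Term Γ s) → T ∣ Δ ⊢ t ≐ t
    ≐subst   : ∀ {Δ s} {t u : Term Γ s} (φ : Formula (s ∷ Γ)) →
               T ∣ Δ ⊢ t ≐ u → T ∣ Δ ⊢ φ [ t ] → T ∣ Δ ⊢ φ [ u ]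
    nonempty : ∀ {Δ φ} (s : Sort) → T ∣ map wkF Δ ⊢ wkF {t = s} φ → T ∣ Δ ⊢ φ

  _⊢_ : Theory → Sentence → Set
  T ⊢ φ = T ∣ [] ⊢ φ

data TCFun : Set where
  emp bconst star : TCFun

tcDom : TCFun → List ⊤
tcDom emp    = []
tcDom bconst = []
tcDom star   = tt ∷ tt ∷ []

TCb-Sig : Signature
TCb-Sig = record { Sort = ⊤ ; Fun = TCFun ; dom = tcDom ; cod = λ _ → tt }

module TC = Syntax TCb-Sig

module TCNotation where
  open TC
  ∅ : ∀ {Γ} → Term Γ tt
  ∅ = app emp []
  𝐛 : ∀ {Γ} → Term Γ tt
  𝐛 = app bconst []
  infixl 7 _*_
  _*_ : ∀ {Γ} → Term Γ tt → Term Γ tt → Term Γ tt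
  x * y = app star (x ∷ y ∷ [])
  v0 : ∀ {Γ} → Term (tt ∷ Γ) tt
  v0 = var here
  v1 : ∀ {Γ} → Term (tt ∷ tt ∷ Γ) tt
  v1 = var (there here)
  v2 : ∀ {Γ} → Term (tt ∷ tt ∷ tt ∷ Γ) tt
  v2 = var (there (there here))
  v3 : ∀ {Γ} → Term (tt ∷ tt ∷ tt ∷ tt ∷ Γ) tt
  v3 = var (there (there (there here)))
  v4 : ∀ {Γ} → Term (tt ∷ tt ∷ tt ∷ tt ∷ tt ∷ Γ) tt
  v4 = var (there (there (there (there here))))

  ∀' : ∀ {Γ} → Formula (tt ∷ Γ) → Formula Γ
  ∀' = all tt
  ∃' : ∀ {Γ} → Formula (tt ∷ Γ) → Formula Γ
  ∃' = ex tt

  isAtom : ∀ {Γ} → Term Γ tt → Formula Γ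
  isAtom a = ¬' (a ≐ ∅) ∧' ∀' (∀' ((v1 * v0 ≐ wkT (wkT a)) ⇒ ((v1 ≐ ∅) ∨' (v0 ≐ ∅))))

  infix 4 _⪯_ _⪯ini_
  _⪯_ : ∀ {Γ} → Term Γ tt → Term Γ tt → Formula Γ
  x ⪯ y = ∃' (∃' (wkT (wkT y) ≐ (v1 * wkT (wkT x)) * v0))

  _⪯ini_ : ∀ {Γ} → Term Γ tt → Term Γ tt → Formula Γ
  x ⪯ini y = ∃' (wkT y ≐ wkT x * v0)

open TCNotation public

module TCAxioms where
 open TC
 data TC₁b-Ax : TC.Sentence → Set where
   ax-unit  : TC₁b-Ax (∀' ((∅ * v0 ≐ v0) ∧' (v0 * ∅ ≐ v0)))
   ax-nodiv : TC₁b-Ax (∀' (∀' ((v1 * v0 ≐ ∅) ⇒ ((v1 ≐ ∅) ∧' (v0 ≐ ∅)))))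
   ax-assoc : TC₁b-Ax (∀' (∀' (∀' ((v2 * v1) * v0 ≐ v2 * (v1 * v0)))))
   -- x = v3, y = v2, u = v1, v = v0 ; inside ∃w: w = v0, x = v4, y = v3, u = v2, v = v1
   ax-EP    : TC₁b-Ax (∀' (∀' (∀' (∀' ((v3 * v2 ≐ v1 * v0) ⇒
                ∃' (((v4 * v0 ≐ v2) ∧' (v3 ≐ v0 * v1)) ∨'
                    ((v4 ≐ v2 * v0) ∧' (v0 * v3 ≐ v1))))))))
   ax-atom  : TC₁b-Ax (isAtom 𝐛)

open TCAxioms public

-- UTC₁: sorts 𝔬 (objects) and 𝔰 (strings)

data USort : Set where
  𝔬 𝔰 : USort

data UFun : Set where
  oslash bracket ustar : UFun

uDom : UFun → List USort
uDom oslash  = []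
uDom bracket = 𝔬 ∷ []
uDom ustar   = 𝔰 ∷ 𝔰 ∷ []

UTC-Sig : Signature
UTC-Sig = record { Sort = USort ; Fun = UFun ; dom = uDom ; cod = λ _ → 𝔰 }

module U = Syntax UTC-Sig

module UNotation where
  open U
  ⊘ : ∀ {Γ} → Term Γ 𝔰
  ⊘ = app oslash []
  [_]' : ∀ {Γ} → Term Γ 𝔬 → Term Γ 𝔰
  [ x ]' = app bracket (x ∷ [])
  infixl 7 _⋆_
  _⋆_ : ∀ {Γ} → Term Γ 𝔰 → Term Γ 𝔰 → Term Γ 𝔰
  x ⋆ y = app ustar (x ∷ y ∷ [])
  w0 : ∀ {Γ s} → Term (s ∷ Γ) s
  w0 = var here
  w1 : ∀ {Γ s t} → Term (t ∷ s ∷ Γ) s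
  w1 = var (there here)
  w2 : ∀ {Γ s t r} → Term (r ∷ t ∷ s ∷ Γ) s
  w2 = var (there (there here))
  w3 : ∀ {Γ s t r q} → Term (q ∷ r ∷ t ∷ s ∷ Γ) s
  w3 = var (there (there (there here)))
  w4 : ∀ {Γ s t r q p} → Term (p ∷ q ∷ r ∷ t ∷ s ∷ Γ) s
  w4 = var (there (there (there (there here))))

  isAtomU : ∀ {Γ} → Term Γ 𝔰 → Formula Γ
  isAtomU a = ¬' (a ≐ ⊘) ∧'
    all 𝔰 (all 𝔰 ((w1 ⋆ w0 ≐ wkT (wkT a)) ⇒ ((w1 ≐ ⊘) ∨' (w0 ≐ ⊘))))

open UNotation public

module UAxioms where
 open U
 data UTC₁-Ax : U.Sentence → Set where
   uax-unit  : UTC₁-Ax (all 𝔰 ((⊘ ⋆ w0 ≐ w0) ∧' (w0 ⋆ ⊘ ≐ w0)))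
   uax-nodiv : UTC₁-Ax (all 𝔰 (all 𝔰 ((w1 ⋆ w0 ≐ ⊘) ⇒ ((w1 ≐ ⊘) ∧' (w0 ≐ ⊘)))))
   uax-assoc : UTC₁-Ax (all 𝔰 (all 𝔰 (all 𝔰 ((w2 ⋆ w1) ⋆ w0 ≐ w2 ⋆ (w1 ⋆ w0)))))
   uax-atom  : UTC₁-Ax (all 𝔬 (isAtomU [ w0 ]'))
   uax-inj   : UTC₁-Ax (all 𝔬 (all 𝔬 (([ w1 ]' ≐ [ w0 ]') ⇒ (w1 ≐ w0))))
   -- α = w3, β = w2, γ = w1, δ = w0 ; inside ∃η: η = w0, α = w4, β = w3, γ = w2, δ = w1
   uax-EP    : UTC₁-Ax (all 𝔰 (all 𝔰 (all 𝔰 (all 𝔰 ((w3 ⋆ w2 ≐ w1 ⋆ w0) ⇒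
                 ex 𝔰 (((w4 ⋆ w0 ≐ w2) ∧' (w3 ≐ w0 ⋆ w1)) ∨'
                       ((w4 ≐ w2 ⋆ w0) ∧' (w0 ⋆ w3 ≐ w1))))))))

open UAxioms public

γCtx : U.Ctx → TC.Ctx
γCtx []      = []
γCtx (_ ∷ Γ) = tt ∷ γCtx Γ

γVar : ∀ {Γ s} → Γ U.∋ s → γCtx Γ TC.∋ tt
γVar U.here      = TC.here
γVar (U.there x) = TC.there (γVar x)

γTerm : ∀ {Γ s} → U.Term Γ s → TC.Term (γCtx Γ) tt
γTerm (U.var x)            = TC.var (γVar x)
γTerm (U.app oslash ts)    = ∅
γTerm (U.app bracket (x U.∷ U.[])) = 𝐛 * γTerm x
γTerm (U.app ustar (x U.∷ (y U.∷ U.[]))) = γTerm x * γTerm y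

δ : ∀ {Γ} → USort → TC.Term Γ tt → TC.Formula Γ
δ 𝔬 x = (x TC.≐ ∅) TC.∨' TC.¬' (𝐛 ⪯ x)
δ 𝔰 x = (x TC.≐ ∅) TC.∨' (𝐛 ⪯ini x)

γ : ∀ {Γ} → U.Formula Γ → TC.Formula (γCtx Γ)
γ (t U.≐ u)   = γTerm t TC.≐ γTerm u
γ U.⊥'        = TC.⊥'
γ (φ U.⇒ ψ)   = γ φ TC.⇒ γ ψ
γ (U.all s φ) = TC.all tt (δ s v0 TC.⇒ γ φ)

{-# OPTIONS --safe #-}
-- A UTC₁-derivation with free variables Γ becomes a TC₁(𝐛)-derivation that also assumes
-- δ s x for every free variable x : s.  Translated terms stay in their domain, since the
-- string domain contains ∅ and every 𝐛 * x and is closed under *; so the quantifier rules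
-- go through, and it remains to derive the translated axioms.  Unit, conicality and
-- associativity are inherited.  Injectivity of [·] is left cancellation of the atom 𝐛,
-- which the editors principle provides.  In the editors principle the witness is a left
-- factor of a string, and the string domain is closed under left factors.  Finally 𝐛 * x
-- is an atom among strings: (𝐛 * y) * (𝐛 * z) = 𝐛 * x cancels to x = (y * 𝐛) * z, so
-- 𝐛 ⪯ x, which the object domain forbids (and x = ∅ would force 𝐛 = ∅).
module Submission where

open import Defs
open import Data.List using (List; []; _∷_; map; _++_)
open import Data.List.Properties using (map-++; map-cong; map-∘)
open import Data.Unit using (tt)
open import Relation.Binary.PropositionalEquality
  using (_≡_; refl; sym; trans; cong; cong₂; subst; module ≡-Reasoning)

module SubstitutionLemmas (Sg : Signature) where
  open Signature Sg
  open Syntax Sg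

  private variable
    Γ Δ Θ : Ctx
    s r : Sort
    ss : List Sort

  infix 4 _≗_
  _≗_ : Sub Γ Δ → Sub Γ Δ → Set
  _≗_ {Γ = Γ} σ τ = ∀ {s} (x : Γ ∋ s) → σ x ≡ τ x

  infixr 9 _⊙_
  _⊙_ : Sub Δ Θ → Sub Γ Δ → Sub Γ Θ
  (σ ⊙ τ) x = subT σ (τ x)

  ⌜_⌝ : Ren Γ Δ → Sub Γ Δ
  ⌜ ρ ⌝ x = var (ρ x)

  infixr 5 _∷ₛ_
  _∷ₛ_ : Term Γ s → Sub Θ Γ → Sub (s ∷ Θ) Γ
  (t ∷ₛ σ) here      = t
  (t ∷ₛ σ) (there x) = σ x

  []ₛ : Sub [] Γ
  []ₛ ()

  mutual
    subT-cong : {σ τ : Sub Γ Δ} → σ ≗ τ → (t : Term Γ s) → subT σ t ≡ subT τ t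
    subT-cong e (var x)    = e x
    subT-cong e (app f ts) = cong (app f) (subTs-cong e ts)

    subTs-cong : {σ τ : Sub Γ Δ} → σ ≗ τ → (ts : Terms Γ ss) → subTs σ ts ≡ subTs τ ts
    subTs-cong e []       = refl
    subTs-cong e (t ∷ ts) = cong₂ _∷_ (subT-cong e t) (subTs-cong e ts)

  mutual
    subT-subT : (σ : Sub Δ Θ) (τ : Sub Γ Δ) (t : Term Γ s) → subT σ (subT τ t) ≡ subT (σ ⊙ τ) t
    subT-subT σ τ (var x)    = refl
    subT-subT σ τ (app f ts) = cong (app f) (subTs-subTs σ τ ts)

    subTs-subTs : (σ : Sub Δ Θ) (τ : Sub Γ Δ) (ts : Terms Γ ss) →
                  subTs σ (subTs τ ts) ≡ subTs (σ ⊙ τ) ts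
    subTs-subTs σ τ []       = refl
    subTs-subTs σ τ (t ∷ ts) = cong₂ _∷_ (subT-subT σ τ t) (subTs-subTs σ τ ts)

  mutual
    subT-var : (t : Term Γ s) → subT var t ≡ t
    subT-var (var x)    = refl
    subT-var (app f ts) = cong (app f) (subTs-var ts)

    subTs-var : (ts : Terms Γ ss) → subTs var ts ≡ ts
    subTs-var []       = refl
    subTs-var (t ∷ ts) = cong₂ _∷_ (subT-var t) (subTs-var ts)

  mutual
    renT≡subT : (ρ : Ren Γ Δ) (t : Term Γ s) → renT ρ t ≡ subT ⌜ ρ ⌝ t
    renT≡subT ρ (var x)    = refl
    renT≡subT ρ (app f ts) = cong (app f) (renTs≡subTs ρ ts)

    renTs≡subTs : (ρ : Ren Γ Δ) (ts : Terms Γ ss) → renTs ρ ts ≡ subTs ⌜ ρ ⌝ ts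
    renTs≡subTs ρ []       = refl
    renTs≡subTs ρ (t ∷ ts) = cong₂ _∷_ (renT≡subT ρ t) (renTs≡subTs ρ ts)

  subT-renT : (σ : Sub Δ Θ) (ρ : Ren Γ Δ) (t : Term Γ s) →
              subT σ (renT ρ t) ≡ subT (λ x → σ (ρ x)) t
  subT-renT σ ρ t = trans (cong (subT σ) (renT≡subT ρ t)) (subT-subT σ ⌜ ρ ⌝ t)

  subT-wkT : (σ : Sub Γ Δ) (t : Term Γ s) → subT (liftS {t = r} σ) (wkT t) ≡ wkT (subT σ t)
  subT-wkT σ t = begin
    subT (liftS σ) (wkT t)          ≡⟨ subT-renT (liftS σ) there t ⟩
    subT (λ x → wkT (σ x)) t        ≡⟨ subT-cong (λ x → renT≡subT there (σ x)) t ⟩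
    subT (⌜ there ⌝ ⊙ σ) t          ≡⟨ subT-subT ⌜ there ⌝ σ t ⟨
    subT ⌜ there ⌝ (subT σ t)       ≡⟨ renT≡subT there (subT σ t) ⟨
    wkT (subT σ t)                  ∎
    where open ≡-Reasoning

  wkT-inst : (u : Term Γ r) (t : Term Γ s) → subT (single u) (wkT t) ≡ t
  wkT-inst u t = trans (subT-renT (single u) there t) (subT-var t)

  liftS-cong : {σ τ : Sub Γ Δ} → σ ≗ τ → liftS {t = s} σ ≗ liftS τ
  liftS-cong e here      = refl
  liftS-cong e (there x) = cong wkT (e x)

  subF-cong : {σ τ : Sub Γ Δ} → σ ≗ τ → (φ : Formula Γ) → subF σ φ ≡ subF τ φ
  subF-cong e (t ≐ u)   = cong₂ _≐_ (subT-cong e t) (subT-cong e u)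
  subF-cong e ⊥'        = refl
  subF-cong e (φ ⇒ ψ)   = cong₂ _⇒_ (subF-cong e φ) (subF-cong e ψ)
  subF-cong e (all s φ) = cong (all s) (subF-cong (liftS-cong e) φ)

  subF-subF : (σ : Sub Δ Θ) (τ : Sub Γ Δ) (φ : Formula Γ) → subF σ (subF τ φ) ≡ subF (σ ⊙ τ) φ
  subF-subF σ τ (t ≐ u)   = cong₂ _≐_ (subT-subT σ τ t) (subT-subT σ τ u)
  subF-subF σ τ ⊥'        = refl
  subF-subF σ τ (φ ⇒ ψ)   = cong₂ _⇒_ (subF-subF σ τ φ) (subF-subF σ τ ψ)
  subF-subF σ τ (all s φ) =
    cong (all s) (trans (subF-subF (liftS σ) (liftS τ) φ) (subF-cong liftS-⊙ φ))
    where
    liftS-⊙ : liftS σ ⊙ liftS τ ≗ liftS {t = s} (σ ⊙ τ)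
    liftS-⊙ here      = refl
    liftS-⊙ (there x) = subT-wkT σ (τ x)

  subF-var : (φ : Formula Γ) → subF var φ ≡ φ
  subF-var (t ≐ u)   = cong₂ _≐_ (subT-var t) (subT-var u)
  subF-var ⊥'        = refl
  subF-var (φ ⇒ ψ)   = cong₂ _⇒_ (subF-var φ) (subF-var ψ)
  subF-var (all s φ) = cong (all s) (trans (subF-cong liftS-var φ) (subF-var φ))
    where
    liftS-var : liftS var ≗ var
    liftS-var here      = refl
    liftS-var (there x) = refl

  renF≡subF : (ρ : Ren Γ Δ) (φ : Formula Γ) → renF ρ φ ≡ subF ⌜ ρ ⌝ φ
  renF≡subF ρ (t ≐ u)   = cong₂ _≐_ (renT≡subT ρ t) (renT≡subT ρ u)
  renF≡subF ρ ⊥'        = refl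
  renF≡subF ρ (φ ⇒ ψ)   = cong₂ _⇒_ (renF≡subF ρ φ) (renF≡subF ρ ψ)
  renF≡subF ρ (all s φ) = cong (all s) (trans (renF≡subF (liftR ρ) φ) (subF-cong liftR≗liftS φ))
    where
    liftR≗liftS : ⌜ liftR ρ ⌝ ≗ liftS {t = s} ⌜ ρ ⌝
    liftR≗liftS here      = refl
    liftR≗liftS (there x) = refl

  subF-renF : (σ : Sub Δ Θ) (ρ : Ren Γ Δ) (φ : Formula Γ) →
              subF σ (renF ρ φ) ≡ subF (λ x → σ (ρ x)) φ
  subF-renF σ ρ φ = trans (cong (subF σ) (renF≡subF ρ φ)) (subF-subF σ ⌜ ρ ⌝ φ)

  wkF-inst : (u : Term Γ r) (φ : Formula Γ) → wkF φ [ u ] ≡ φ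
  wkF-inst u φ = trans (subF-renF (single u) there φ) (subF-var φ)

  inst-fresh : (φ : Formula (s ∷ Γ)) → renF (liftR there) φ [ var here ] ≡ φ
  inst-fresh φ = trans (subF-renF _ (liftR there) φ) (trans (subF-cong fresh φ) (subF-var φ))
    where
    fresh : (λ x → single (var here) (liftR there x)) ≗ var
    fresh here      = refl
    fresh (there x) = refl

  inst-liftS : (σ : Sub (s ∷ Θ) Γ) (φ : Formula (s ∷ Θ)) →
               subF (liftS (λ x → σ (there x))) φ [ σ here ] ≡ subF σ φ
  inst-liftS σ φ = trans (subF-subF _ (liftS _) φ) (subF-cong split φ)
    where
    split : single (σ here) ⊙ liftS (λ x → σ (there x)) ≗ σ
    split here      = refl
    split (there x) = wkT-inst (σ here) (σ (there x))

  closedF≡subF : (σ : Sub [] Γ) (φ : Sentence) → closedF φ ≡ subF σ φ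
  closedF≡subF σ φ = trans (renF≡subF emptyRen φ) (subF-cong (λ ()) φ)

module Derivations (Sg : Signature) (T : Syntax.Theory Sg) where
  open Signature Sg
  open Syntax Sg
  open SubstitutionLemmas Sg

  private variable
    Γ Γ' Θ : Ctx
    p q r s : Sort
    t u v : Term Γ s
    φ ψ χ φ₀ φ₁ φ₂ φ₃ φ₄ : Formula Γ
    Δ Δ' : List (Formula Γ)

  infix 4 _⊆_
  _⊆_ : List (Formula Γ) → List (Formula Γ) → Set
  Δ ⊆ Δ' = ∀ {φ} → φ ∈H Δ → φ ∈H Δ'

  keep : Δ ⊆ Δ' → φ ∷ Δ ⊆ φ ∷ Δ'
  keep Δ⊆Δ' here      = here
  keep Δ⊆Δ' (there p) = there (Δ⊆Δ' p)

  ∈H-map⁺ : (f : Formula Γ → Formula Γ') → φ ∈H Δ → f φ ∈H map f Δ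
  ∈H-map⁺ f here      = here
  ∈H-map⁺ f (there p) = there (∈H-map⁺ f p)

  map⁺-⊆ : (f : Formula Γ → Formula Γ') → Δ ⊆ Δ' → map f Δ ⊆ map f Δ'
  map⁺-⊆ {Δ = _ ∷ _} f Δ⊆Δ' here      = ∈H-map⁺ f (Δ⊆Δ' here)
  map⁺-⊆ {Δ = _ ∷ _} f Δ⊆Δ' (there p) = map⁺-⊆ f (λ q → Δ⊆Δ' (there q)) p

  ∈H-++⁺ˡ : φ ∈H Δ → φ ∈H Δ ++ Δ'
  ∈H-++⁺ˡ here      = here
  ∈H-++⁺ˡ (there p) = there (∈H-++⁺ˡ p)

  ∈H-++⁺ʳ : (Δ : List (Formula Γ)) → φ ∈H Δ' → φ ∈H Δ ++ Δ'
  ∈H-++⁺ʳ []      p = p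
  ∈H-++⁺ʳ (_ ∷ Δ) p = there (∈H-++⁺ʳ Δ p)

  ++-∷-⊆ : (Δ : List (Formula Γ)) → Δ ++ φ ∷ Δ' ⊆ φ ∷ Δ ++ Δ'
  ++-∷-⊆ []      p         = p
  ++-∷-⊆ (_ ∷ Δ) here      = there here
  ++-∷-⊆ (_ ∷ Δ) (there p) with ++-∷-⊆ Δ p
  ... | here    = here
  ... | there q = there (there q)

  weaken : Δ ⊆ Δ' → T ∣ Δ ⊢ φ → T ∣ Δ' ⊢ φ
  weaken Δ⊆Δ' (axiom a)        = axiom a
  weaken Δ⊆Δ' (hyp p)          = hyp (Δ⊆Δ' p)
  weaken Δ⊆Δ' (⇒I d)           = ⇒I (weaken (keep Δ⊆Δ') d)
  weaken Δ⊆Δ' (⇒E d e)         = ⇒E (weaken Δ⊆Δ' d) (weaken Δ⊆Δ' e)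
  weaken Δ⊆Δ' (raa d)          = raa (weaken (keep Δ⊆Δ') d)
  weaken Δ⊆Δ' (∀I d)           = ∀I (weaken (map⁺-⊆ wkF Δ⊆Δ') d)
  weaken Δ⊆Δ' (∀E d t)         = ∀E (weaken Δ⊆Δ' d) t
  weaken Δ⊆Δ' (≐refl t)        = ≐refl t
  weaken Δ⊆Δ' (≐subst φ e d)   = ≐subst φ (weaken Δ⊆Δ' e) (weaken Δ⊆Δ' d)
  weaken Δ⊆Δ' (nonempty s d)   = nonempty s (weaken (map⁺-⊆ wkF Δ⊆Δ') d)

  wk : T ∣ Δ ⊢ φ → T ∣ ψ ∷ Δ ⊢ φ
  wk = weaken there

  cast : φ ≡ ψ → T ∣ Δ ⊢ φ → T ∣ Δ ⊢ ψ
  cast refl d = d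

  hyp₀ : T ∣ φ ∷ Δ ⊢ φ
  hyp₀ = hyp here

  hyp₁ : T ∣ φ₀ ∷ φ ∷ Δ ⊢ φ
  hyp₁ = hyp (there here)

  hyp₂ : T ∣ φ₀ ∷ φ₁ ∷ φ ∷ Δ ⊢ φ
  hyp₂ = wk hyp₁

  hyp₃ : T ∣ φ₀ ∷ φ₁ ∷ φ₂ ∷ φ ∷ Δ ⊢ φ
  hyp₃ = wk hyp₂

  hyp₄ : T ∣ φ₀ ∷ φ₁ ∷ φ₂ ∷ φ₃ ∷ φ ∷ Δ ⊢ φ
  hyp₄ = wk hyp₃

  hyp₅ : T ∣ φ₀ ∷ φ₁ ∷ φ₂ ∷ φ₃ ∷ φ₄ ∷ φ ∷ Δ ⊢ φ
  hyp₅ = wk hyp₄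

  ⊥E : T ∣ Δ ⊢ ⊥' → T ∣ Δ ⊢ φ
  ⊥E d = raa (wk d)

  ∧I : T ∣ Δ ⊢ φ → T ∣ Δ ⊢ ψ → T ∣ Δ ⊢ φ ∧' ψ
  ∧I p q = ⇒I (⇒E (⇒E hyp₀ (wk p)) (wk q))

  ∧E₁ : T ∣ Δ ⊢ φ ∧' ψ → T ∣ Δ ⊢ φ
  ∧E₁ p = raa (⇒E (wk p) (⇒I (⇒I (⇒E hyp₂ hyp₁))))

  ∧E₂ : T ∣ Δ ⊢ φ ∧' ψ → T ∣ Δ ⊢ ψ
  ∧E₂ p = raa (⇒E (wk p) (⇒I (⇒I (⇒E hyp₂ hyp₀))))

  ∨I₁ : T ∣ Δ ⊢ φ → T ∣ Δ ⊢ φ ∨' ψ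
  ∨I₁ p = ⇒I (⊥E (⇒E hyp₀ (wk p)))

  ∨I₂ : T ∣ Δ ⊢ ψ → T ∣ Δ ⊢ φ ∨' ψ
  ∨I₂ q = ⇒I (wk q)

  ∨E : T ∣ Δ ⊢ φ ∨' ψ → T ∣ φ ∷ Δ ⊢ χ → T ∣ ψ ∷ Δ ⊢ χ → T ∣ Δ ⊢ χ
  ∨E p f g = raa (⇒E hyp₀ (⇒E (⇒I (weaken (keep there) g))
                            (⇒E (wk p) (⇒I (⇒E hyp₁ (weaken (keep there) f))))))

  ∃I : {φ : Formula (s ∷ Γ)} (t : Term Γ s) → T ∣ Δ ⊢ φ [ t ] → T ∣ Δ ⊢ ex s φ
  ∃I t p = ⇒I (⇒E (∀E hyp₀ t) (wk p))

  ∃E : {φ : Formula (s ∷ Γ)} → T ∣ Δ ⊢ ex s φ → T ∣ φ ∷ map wkF Δ ⊢ wkF χ → T ∣ Δ ⊢ χ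
  ∃E p f = raa (⇒E (wk p) (∀I (⇒I (⇒E hyp₁ (weaken (keep there) f)))))

  ∀E-fresh : {φ : Formula (s ∷ Γ)} → T ∣ Δ ⊢ wkF (all s φ) → T ∣ Δ ⊢ φ
  ∀E-fresh d = cast (inst-fresh _) (∀E d (var here))

  -- A relativised existential has the shape ¬ ∀x (ψ ⇒ ¬ φ), ψ the domain formula.
  ∃-restrict : {φ ψ : Formula (s ∷ Γ)} →
               T ∣ Δ ⊢ ex s φ → T ∣ φ ∷ map wkF Δ ⊢ ψ → T ∣ Δ ⊢ ¬' (all s (ψ ⇒ ¬' φ))
  ∃-restrict e f =
    ⇒I (⇒E (wk e) (∀I (⇒I (⇒E (⇒E (∀E-fresh hyp₁) (weaken (keep there) f)) hyp₀))))

  close : Formula Θ → Sentence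
  close {Θ = []}    φ = φ
  close {Θ = s ∷ Θ} φ = close (all s φ)

  -- A schematic lemma about terms is derived as a closed universal sentence about
  -- variables and then instantiated: on variables all substitutions compute.
  instantiate : (φ : Formula Θ) (σ : Sub Θ Γ) → T ∣ Δ ⊢ closedF (close φ) → T ∣ Δ ⊢ subF σ φ
  instantiate {Θ = []}    φ σ d = cast (closedF≡subF σ φ) d
  instantiate {Θ = s ∷ Θ} φ σ d =
    cast (inst-liftS σ φ) (∀E (instantiate (all s φ) (λ x → σ (there x)) d) (σ here))

  private
    x₀ : Term (s ∷ Γ) s
    x₀ = var here

    x₁ : Term (r ∷ s ∷ Γ) s
    x₁ = var (there here)

    x₂ : Term (q ∷ r ∷ s ∷ Γ) s
    x₂ = var (there (there here))

    x₃ : Term (p ∷ q ∷ r ∷ s ∷ Γ) s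
    x₃ = var (there (there (there here)))

  ≐-sym : T ∣ Δ ⊢ t ≐ u → T ∣ Δ ⊢ u ≐ t
  ≐-sym {t = t} {u = u} = ⇒E (instantiate ((x₁ ≐ x₀) ⇒ (x₀ ≐ x₁)) (u ∷ₛ t ∷ₛ []ₛ)
                                (∀I (∀I (⇒I (≐subst (x₀ ≐ x₂) hyp₀ (≐refl x₁))))))

  ≐-trans : T ∣ Δ ⊢ t ≐ u → T ∣ Δ ⊢ u ≐ v → T ∣ Δ ⊢ t ≐ v
  ≐-trans {t = t} {u = u} {v = v} e f =
    ⇒E (⇒E (instantiate ((x₂ ≐ x₁) ⇒ (x₁ ≐ x₀) ⇒ (x₂ ≐ x₀)) (v ∷ₛ u ∷ₛ t ∷ₛ []ₛ)
              (∀I (∀I (∀I (⇒I (⇒I (≐subst (x₃ ≐ x₀) hyp₀ hyp₁))))))) e) f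

module TC₁bReasoning where
  open TC
  open SubstitutionLemmas TCb-Sig using (_∷ₛ_; []ₛ)
  open Derivations TCb-Sig TC₁b-Ax public

  private variable
    Γ : Ctx
    Δ Λ : List (Formula Γ)
    t t' u u' v w x y z : Term Γ tt
    φ₀ φ₁ : Formula Γ

  infix 0 _⊩_
  _⊩_ : List (Formula Γ) → Formula Γ → Set
  Δ ⊩ φ = TC₁b-Ax ∣ Δ ⊢ φ

  identity : (t : Term Γ tt) → Δ ⊩ (∅ * t ≐ t) ∧' (t * ∅ ≐ t)
  identity t = instantiate ((∅ * v0 ≐ v0) ∧' (v0 * ∅ ≐ v0)) (t ∷ₛ []ₛ) (axiom ax-unit)

  identityˡ : (t : Term Γ tt) → Δ ⊩ ∅ * t ≐ t
  identityˡ t = ∧E₁ (identity t)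

  identityʳ : (t : Term Γ tt) → Δ ⊩ t * ∅ ≐ t
  identityʳ t = ∧E₂ (identity t)

  conical : Δ ⊩ t * u ≐ ∅ → Δ ⊩ (t ≐ ∅) ∧' (u ≐ ∅)
  conical {t = t} {u = u} =
    ⇒E (instantiate ((v1 * v0 ≐ ∅) ⇒ ((v1 ≐ ∅) ∧' (v0 ≐ ∅))) (u ∷ₛ t ∷ₛ []ₛ) (axiom ax-nodiv))

  conicalˡ : Δ ⊩ t * u ≐ ∅ → Δ ⊩ t ≐ ∅
  conicalˡ e = ∧E₁ (conical e)

  conicalʳ : Δ ⊩ t * u ≐ ∅ → Δ ⊩ u ≐ ∅
  conicalʳ e = ∧E₂ (conical e)

  assoc : (t u v : Term Γ tt) → Δ ⊩ (t * u) * v ≐ t * (u * v)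
  assoc t u v =
    instantiate ((v2 * v1) * v0 ≐ v2 * (v1 * v0)) (v ∷ₛ u ∷ₛ t ∷ₛ []ₛ) (axiom ax-assoc)

  editors : Δ ⊩ x * y ≐ u * v →
            Δ ⊩ ∃' (((wkT x * v0 ≐ wkT u) ∧' (wkT y ≐ v0 * wkT v)) ∨'
                    ((wkT x ≐ wkT u * v0) ∧' (v0 * wkT y ≐ wkT v)))
  editors {x = x} {y = y} {u = u} {v = v} =
    ⇒E (instantiate ((v3 * v2 ≐ v1 * v0) ⇒
                       ∃' (((v4 * v0 ≐ v2) ∧' (v3 ≐ v0 * v1)) ∨'
                           ((v4 ≐ v2 * v0) ∧' (v0 * v3 ≐ v1))))
                    (v ∷ₛ u ∷ₛ y ∷ₛ x ∷ₛ []ₛ) (axiom ax-EP))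

  𝐛≢∅ : Δ ⊩ ¬' (𝐛 ≐ ∅)
  𝐛≢∅ = ∧E₁ (axiom ax-atom)

  𝐛-atom : Δ ⊩ t * u ≐ 𝐛 → Δ ⊩ (t ≐ ∅) ∨' (u ≐ ∅)
  𝐛-atom {t = t} {u = u} =
    ⇒E (instantiate ((v1 * v0 ≐ 𝐛) ⇒ ((v1 ≐ ∅) ∨' (v0 ≐ ∅))) (u ∷ₛ t ∷ₛ []ₛ)
                    (∧E₂ (axiom ax-atom)))

  *-congʳ : Δ ⊩ t ≐ u → Δ ⊩ t * w ≐ u * w
  *-congʳ {t = t} {u = u} {w = w} =
    ⇒E (instantiate ((v2 ≐ v1) ⇒ (v2 * v0 ≐ v1 * v0)) (w ∷ₛ u ∷ₛ t ∷ₛ []ₛ)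
                    (∀I (∀I (∀I (⇒I (≐subst (v3 * v1 ≐ v0 * v1) hyp₀ (≐refl (v2 * v0))))))))

  *-congˡ : Δ ⊩ t ≐ u → Δ ⊩ w * t ≐ w * u
  *-congˡ {t = t} {u = u} {w = w} =
    ⇒E (instantiate ((v2 ≐ v1) ⇒ (v0 * v2 ≐ v0 * v1)) (w ∷ₛ u ∷ₛ t ∷ₛ []ₛ)
                    (∀I (∀I (∀I (⇒I (≐subst (v1 * v3 ≐ v1 * v0) hyp₀ (≐refl (v0 * v2))))))))

  *-cong : Δ ⊩ t ≐ t' → Δ ⊩ u ≐ u' → Δ ⊩ t * u ≐ t' * u'
  *-cong e f = ≐-trans (*-congʳ e) (*-congˡ f)

  𝐛*w≐𝐛⇒w≐∅ : Δ ⊩ 𝐛 * w ≐ 𝐛 → Δ ⊩ w ≐ ∅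
  𝐛*w≐𝐛⇒w≐∅ e = ∨E (𝐛-atom e) (⊥E (⇒E 𝐛≢∅ hyp₀)) hyp₀

  𝐛*w≐𝐛⇒w*u≐u : Δ ⊩ 𝐛 * w ≐ 𝐛 → Δ ⊩ w * u ≐ u
  𝐛*w≐𝐛⇒w*u≐u {u = u} e = ≐-trans (*-congʳ (𝐛*w≐𝐛⇒w≐∅ e)) (identityˡ u)

  𝐛-cancelˡ : Δ ⊩ 𝐛 * t ≐ 𝐛 * u → Δ ⊩ t ≐ u
  𝐛-cancelˡ e = ∃E (editors e) (∨E hyp₀
    (≐-trans (∧E₂ hyp₀) (𝐛*w≐𝐛⇒w*u≐u (∧E₁ hyp₀)))
    (≐-sym (≐-trans (≐-sym (∧E₂ hyp₀)) (𝐛*w≐𝐛⇒w*u≐u (≐-sym (∧E₁ hyp₀))))))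

  ⪯-intro : Δ ⊩ t ≐ (u * x) * v → Δ ⊩ x ⪯ t
  ⪯-intro {t = t} {u = u} {x = x} {v = v} =
    ⇒E (instantiate ((v3 ≐ (v1 * v2) * v0) ⇒ (v2 ⪯ v3)) (v ∷ₛ u ∷ₛ x ∷ₛ t ∷ₛ []ₛ)
                    (∀I (∀I (∀I (∀I (⇒I (∃I v1 (∃I v0 hyp₀))))))))

  ⪯ini-intro : Δ ⊩ t ≐ x * w → Δ ⊩ x ⪯ini t
  ⪯ini-intro {t = t} {x = x} {w = w} =
    ⇒E (instantiate ((v2 ≐ v1 * v0) ⇒ (v1 ⪯ini v2)) (w ∷ₛ x ∷ₛ t ∷ₛ []ₛ)
                    (∀I (∀I (∀I (⇒I (∃I v0 hyp₀))))))

  ⪯ini-*ʳ : Δ ⊩ x ⪯ini t → Δ ⊩ x ⪯ini t * u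
  ⪯ini-*ʳ {x = x} {t = t} {u = u} =
    ⇒E (instantiate ((v2 ⪯ini v1) ⇒ (v2 ⪯ini v1 * v0)) (u ∷ₛ t ∷ₛ x ∷ₛ []ₛ)
                    (∀I (∀I (∀I (⇒I (∃E hyp₀
                      (⪯ini-intro (≐-trans (*-congʳ hyp₀) (assoc v3 v0 v1)))))))))

  δ-∅ : ∀ s → Δ ⊩ δ s ∅
  δ-∅ 𝔬 = ∨I₁ (≐refl ∅)
  δ-∅ 𝔰 = ∨I₁ (≐refl ∅)

  δ𝔰-resp-≐ : Δ ⊩ t ≐ u → Δ ⊩ δ 𝔰 t → Δ ⊩ δ 𝔰 u
  δ𝔰-resp-≐ = ≐subst (δ 𝔰 v0)

  δ𝔰-𝐛* : (t : Term Γ tt) → Δ ⊩ δ 𝔰 (𝐛 * t)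
  δ𝔰-𝐛* t = ∨I₂ (⪯ini-intro (≐refl (𝐛 * t)))

  δ𝔰-𝐛 : Δ ⊩ δ 𝔰 𝐛
  δ𝔰-𝐛 = δ𝔰-resp-≐ (identityʳ 𝐛) (δ𝔰-𝐛* ∅)

  δ𝔰-* : Δ ⊩ δ 𝔰 t → Δ ⊩ δ 𝔰 u → Δ ⊩ δ 𝔰 (t * u)
  δ𝔰-* {u = u} dt du =
    ∨E dt (δ𝔰-resp-≐ (≐-trans (≐-sym (identityˡ u)) (*-congʳ (≐-sym hyp₀))) (wk du))
          (∨I₂ (⪯ini-*ʳ hyp₀))

  𝐛≐w*z⇒δ𝔰-w : Δ ⊩ 𝐛 ≐ w * z → Δ ⊩ δ 𝔰 w
  𝐛≐w*z⇒δ𝔰-w {w = w} e =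
    ∨E (𝐛-atom (≐-sym e)) (∨I₁ hyp₀)
       (δ𝔰-resp-≐ (≐-trans (wk e) (≐-trans (*-congˡ hyp₀) (identityʳ w))) δ𝔰-𝐛)

  𝐛⪯ini-prefix : Δ ⊩ 𝐛 ⪯ini t → Δ ⊩ t ≐ w * u → Δ ⊩ δ 𝔰 w
  𝐛⪯ini-prefix {t = t} {w = w} {u = u} d e =
    ⇒E (⇒E (instantiate ((𝐛 ⪯ini v2) ⇒ (v2 ≐ v1 * v0) ⇒ δ 𝔰 v1) (u ∷ₛ w ∷ₛ t ∷ₛ []ₛ)
                        (∀I (∀I (∀I (⇒I (⇒I (∃E hyp₁ body))))))) d) e
    where
    -- The editors principle splits 𝐛 * t' ≐ w * u into w ≐ 𝐛 * z or 𝐛 ≐ w * z.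
    body : ((v3 ≐ 𝐛 * v0) ∷ (v3 ≐ v2 * v1) ∷ Λ) ⊩ δ 𝔰 v2
    body = ∃E (editors (≐-trans (≐-sym hyp₀) hyp₁))
              (∨E hyp₀ (δ𝔰-resp-≐ (∧E₁ hyp₀) (δ𝔰-𝐛* v0)) (𝐛≐w*z⇒δ𝔰-w (∧E₁ hyp₀)))

  δ𝔰-prefix : Δ ⊩ δ 𝔰 t → Δ ⊩ t ≐ w * u → Δ ⊩ δ 𝔰 w
  δ𝔰-prefix d e = ∨E d (∨I₁ (conicalˡ (≐-trans (≐-sym (wk e)) hyp₀))) (𝐛⪯ini-prefix hyp₀ (wk e))

  𝐛*y*𝐛*z≢𝐛*x : Δ ⊩ δ 𝔬 x → Δ ⊩ (𝐛 * y) * (𝐛 * z) ≐ 𝐛 * x → Δ ⊩ ⊥'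
  𝐛*y*𝐛*z≢𝐛*x {Δ = Δ} {x = x} {y = y} {z = z} dx e =
    ∨E dx (⇒E 𝐛≢∅ (conicalˡ (conicalʳ (≐-trans (wk y*𝐛*z≐x) hyp₀))))
          (⇒E hyp₀ (⪯-intro (≐-trans (≐-sym (wk y*𝐛*z≐x)) (≐-sym (assoc y 𝐛 z)))))
    where
    y*𝐛*z≐x : Δ ⊩ y * (𝐛 * z) ≐ x
    y*𝐛*z≐x = 𝐛-cancelˡ (≐-trans (≐-sym (assoc 𝐛 y (𝐛 * z))) e)

  𝐛⪯ini-atom : Δ ⊩ δ 𝔬 x → Δ ⊩ 𝐛 ⪯ini t → Δ ⊩ 𝐛 ⪯ini u → Δ ⊩ t * u ≐ 𝐛 * x → Δ ⊩ ⊥'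
  𝐛⪯ini-atom {Δ = Δ} {x = x} {t = t} {u = u} dx dt du e =
    ⇒E (⇒E (⇒E (⇒E closed dx) dt) du) e
    where
    body : ((v2 ≐ 𝐛 * v0) ∷ (v3 ≐ 𝐛 * v1) ∷ (v3 * v2 ≐ 𝐛 * v4) ∷ φ₀ ∷ φ₁ ∷ δ 𝔬 v4 ∷ Λ) ⊩ ⊥'
    body = 𝐛*y*𝐛*z≢𝐛*x hyp₅ (≐-trans (≐-sym (*-cong hyp₁ hyp₀)) hyp₂)

    closed : Δ ⊩ δ 𝔬 x ⇒ 𝐛 ⪯ini t ⇒ 𝐛 ⪯ini u ⇒ (t * u ≐ 𝐛 * x) ⇒ ⊥'
    closed = instantiate (δ 𝔬 v2 ⇒ 𝐛 ⪯ini v1 ⇒ 𝐛 ⪯ini v0 ⇒ (v1 * v0 ≐ 𝐛 * v2) ⇒ ⊥')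
                         (u ∷ₛ t ∷ₛ x ∷ₛ []ₛ)
                         (∀I (∀I (∀I (⇒I (⇒I (⇒I (⇒I (∃E hyp₂ (∃E hyp₂ body)))))))))

  δ𝔰-atom : Δ ⊩ δ 𝔬 x → Δ ⊩ δ 𝔰 t → Δ ⊩ δ 𝔰 u → Δ ⊩ t * u ≐ 𝐛 * x →
            Δ ⊩ (t ≐ ∅) ∨' (u ≐ ∅)
  δ𝔰-atom dx dt du e =
    ∨E dt (∨I₁ hyp₀)
          (∨E (wk du) (∨I₂ hyp₀) (⊥E (𝐛⪯ini-atom (wk (wk dx)) hyp₁ hyp₀ (wk (wk e)))))

  γ-axiom : ∀ {φ} → UTC₁-Ax φ → Δ ⊩ closedF (γ φ)
  γ-axiom uax-unit  = ∀I (⇒I (identity v0))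
  γ-axiom uax-nodiv = ∀I (⇒I (∀I (⇒I (⇒I (conical hyp₀)))))
  γ-axiom uax-assoc = ∀I (⇒I (∀I (⇒I (∀I (⇒I (assoc v2 v1 v0))))))
  γ-axiom uax-atom  = ∀I (⇒I (∧I (⇒I (⇒E 𝐛≢∅ (conicalˡ hyp₀)))
                                  (∀I (⇒I (∀I (⇒I (⇒I (δ𝔰-atom hyp₃ hyp₂ hyp₁ hyp₀))))))))
  γ-axiom uax-inj   = ∀I (⇒I (∀I (⇒I (⇒I (𝐛-cancelˡ hyp₀)))))
  γ-axiom uax-EP    = ∀I (⇒I (∀I (⇒I (∀I (⇒I (∀I (⇒I (⇒I
    (∃-restrict (editors hyp₀)
                (∨E hyp₀ (δ𝔰-prefix hyp₅ (∧E₂ hyp₀)) (δ𝔰-prefix hyp₃ (≐-sym (∧E₂ hyp₀)))))))))))))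

module Relativisation where
  open TC₁bReasoning
  open TC using (hyp; ⇒I; ⇒E; raa; ∀I; ∀E; ≐refl; ≐subst)
  module SU = SubstitutionLemmas UTC-Sig
  module ST = SubstitutionLemmas TCb-Sig

  private variable
    Γ Γ' : U.Ctx
    s s' : USort
    Δ : List (U.Formula Γ)
    φ : U.Formula Γ

  δ-subF : ∀ s {Θ Θ'} (σ : TC.Sub Θ Θ') (x : Θ TC.∋ tt) →
           TC.subF σ (δ s (TC.var x)) ≡ δ s (σ x)
  δ-subF 𝔬 σ x = refl
  δ-subF 𝔰 σ x = refl

  δ-inst : ∀ s {Θ} (t : TC.Term Θ tt) → δ s v0 TC.[ t ] ≡ δ s t
  δ-inst s t = δ-subF s (TC.single t) TC.here

  δ-renF : ∀ s {Θ Θ'} (ρ : TC.Ren Θ Θ') (x : Θ TC.∋ tt) →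
           TC.renF ρ (δ s (TC.var x)) ≡ δ s (TC.var (ρ x))
  δ-renF 𝔬 ρ x = refl
  δ-renF 𝔰 ρ x = refl

  Tracks : TC.Sub (γCtx Γ) (γCtx Γ') → U.Sub Γ Γ' → Set
  Tracks {Γ = Γ} τ σ = ∀ {s} (x : Γ U.∋ s) → τ (γVar x) ≡ γTerm (σ x)

  γTerm-subT : {τ : TC.Sub (γCtx Γ) (γCtx Γ')} {σ : U.Sub Γ Γ'} → Tracks τ σ →
               (t : U.Term Γ s) → γTerm (U.subT σ t) ≡ TC.subT τ (γTerm t)
  γTerm-subT h (U.var x)                          = sym (h x)
  γTerm-subT h (U.app oslash ts)                  = refl
  γTerm-subT h (U.app bracket (x U.∷ U.[]))       = cong (𝐛 *_) (γTerm-subT h x)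
  γTerm-subT h (U.app ustar (x U.∷ (y U.∷ U.[]))) =
    cong₂ _*_ (γTerm-subT h x) (γTerm-subT h y)

  γTerm-wkT : (t : U.Term Γ s) → γTerm (U.wkT {t = s'} t) ≡ TC.wkT (γTerm t)
  γTerm-wkT t = begin
    γTerm (U.wkT t)                     ≡⟨ cong γTerm (SU.renT≡subT U.there t) ⟩
    γTerm (U.subT SU.⌜ U.there ⌝ t)     ≡⟨ γTerm-subT (λ x → refl) t ⟩
    TC.subT ST.⌜ TC.there ⌝ (γTerm t)   ≡⟨ ST.renT≡subT TC.there (γTerm t) ⟨
    TC.wkT (γTerm t)                    ∎
    where open ≡-Reasoning

  Tracks-liftS : {τ : TC.Sub (γCtx Γ) (γCtx Γ')} {σ : U.Sub Γ Γ'} →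
                 Tracks τ σ → Tracks (TC.liftS τ) (U.liftS {t = s} σ)
  Tracks-liftS h U.here                = refl
  Tracks-liftS {σ = σ} h (U.there x)   = trans (cong TC.wkT (h x)) (sym (γTerm-wkT (σ x)))

  γ-subF : {τ : TC.Sub (γCtx Γ) (γCtx Γ')} {σ : U.Sub Γ Γ'} → Tracks τ σ →
           (φ : U.Formula Γ) → γ (U.subF σ φ) ≡ TC.subF τ (γ φ)
  γ-subF h (t U.≐ u)             = cong₂ TC._≐_ (γTerm-subT h t) (γTerm-subT h u)
  γ-subF h U.⊥'                  = refl
  γ-subF h (φ U.⇒ ψ)             = cong₂ TC._⇒_ (γ-subF h φ) (γ-subF h ψ)
  γ-subF {τ = τ} h (U.all s φ)   = cong (TC.all tt)
    (cong₂ TC._⇒_ (sym (δ-subF s (TC.liftS τ) TC.here)) (γ-subF (Tracks-liftS h) φ))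

  γ-inst : (φ : U.Formula (s ∷ Γ)) (t : U.Term Γ s) → γ (φ U.[ t ]) ≡ γ φ TC.[ γTerm t ]
  γ-inst φ t = γ-subF single-tracks φ
    where
    single-tracks : Tracks (TC.single (γTerm t)) (U.single t)
    single-tracks U.here      = refl
    single-tracks (U.there x) = refl

  γ-renF : (ρ : U.Ren Γ Γ') (ρ' : TC.Ren (γCtx Γ) (γCtx Γ')) →
           (∀ {s} (x : Γ U.∋ s) → ρ' (γVar x) ≡ γVar (ρ x)) →
           (φ : U.Formula Γ) → γ (U.renF ρ φ) ≡ TC.renF ρ' (γ φ)
  γ-renF ρ ρ' h φ = begin
    γ (U.renF ρ φ)            ≡⟨ cong γ (SU.renF≡subF ρ φ) ⟩
    γ (U.subF SU.⌜ ρ ⌝ φ)     ≡⟨ γ-subF (λ x → cong TC.var (h x)) φ ⟩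
    TC.subF ST.⌜ ρ' ⌝ (γ φ)   ≡⟨ ST.renF≡subF ρ' (γ φ) ⟨
    TC.renF ρ' (γ φ)          ∎
    where open ≡-Reasoning

  γ-wkF : (φ : U.Formula Γ) → γ (U.wkF {t = s} φ) ≡ TC.wkF (γ φ)
  γ-wkF = γ-renF U.there TC.there (λ x → refl)

  γ-closedF : (φ : U.Sentence) → γ (U.closedF {Γ} φ) ≡ TC.closedF (γ φ)
  γ-closedF = γ-renF U.emptyRen TC.emptyRen (λ ())

  map-γ-wkF : (Δ : List (U.Formula Γ)) → map γ (map (U.wkF {t = s}) Δ) ≡ map TC.wkF (map γ Δ)
  map-γ-wkF Δ = trans (sym (map-∘ Δ)) (trans (map-cong γ-wkF Δ) (map-∘ Δ))

  ∈H-map-γ : φ U.∈H Δ → γ φ TC.∈H map γ Δ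
  ∈H-map-γ U.here      = TC.here
  ∈H-map-γ (U.there p) = TC.there (∈H-map-γ p)

  Dom : (Γ : U.Ctx) → List (TC.Formula (γCtx Γ))
  Dom []      = []
  Dom (s ∷ Γ) = δ s v0 ∷ map TC.wkF (Dom Γ)

  ∈Dom : (x : Γ U.∋ s) → δ s (TC.var (γVar x)) TC.∈H Dom Γ
  ∈Dom U.here              = TC.here
  ∈Dom {s = s} (U.there x) =
    TC.there (subst (λ ψ → ψ TC.∈H _) (δ-renF s TC.there (γVar x)) (∈H-map⁺ TC.wkF (∈Dom x)))

  γTerm∈δ : {Λ : List (TC.Formula (γCtx Γ))} (t : U.Term Γ s) → Λ ++ Dom Γ ⊩ δ s (γTerm t)
  γTerm∈δ {Λ = Λ} (U.var x)                   = hyp (∈H-++⁺ʳ Λ (∈Dom x))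
  γTerm∈δ (U.app oslash ts)                   = δ-∅ 𝔰
  γTerm∈δ (U.app bracket (x U.∷ U.[]))        = δ𝔰-𝐛* (γTerm x)
  γTerm∈δ (U.app ustar (x U.∷ (y U.∷ U.[])))  = δ𝔰-* (γTerm∈δ x) (γTerm∈δ y)

  ∀I-relativised : {Δ : List (U.Formula Γ)} {ψ : TC.Formula (γCtx (s ∷ Γ))} →
                   map γ (map (U.wkF {t = s}) Δ) ++ Dom (s ∷ Γ) ⊩ ψ →
                   map γ Δ ++ Dom Γ ⊩ TC.all tt (δ s v0 TC.⇒ ψ)
  ∀I-relativised {Γ = Γ} {s = s} {Δ = Δ} d =
    ∀I (⇒I (subst (λ Λ → δ s v0 ∷ Λ ⊩ _) (sym (map-++ TC.wkF (map γ Δ) (Dom Γ)))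
                  (weaken (++-∷-⊆ (map TC.wkF (map γ Δ)))
                          (subst (λ Λ → Λ ++ Dom (s ∷ Γ) ⊩ _) (map-γ-wkF Δ) d))))

  relativise : {Δ : List (U.Formula Γ)} {φ : U.Formula Γ} →
               UTC₁-Ax U.∣ Δ ⊢ φ → map γ Δ ++ Dom Γ ⊩ γ φ
  relativise (U.axiom {φ = φ} a)    = cast (sym (γ-closedF φ)) (γ-axiom a)
  relativise (U.hyp p)              = hyp (∈H-++⁺ˡ (∈H-map-γ p))
  relativise (U.⇒I d)               = ⇒I (relativise d)
  relativise (U.⇒E d e)             = ⇒E (relativise d) (relativise e)
  relativise (U.raa d)              = raa (relativise d)
  relativise (U.∀I d)               = ∀I-relativised (relativise d)
  relativise (U.∀E {s = s} {φ = φ} d t) =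
    cast (sym (γ-inst φ t))
         (⇒E (∀E (relativise d) (γTerm t))
             (cast (sym (δ-inst s (γTerm t))) (γTerm∈δ t)))
  relativise (U.≐refl t)            = ≐refl (γTerm t)
  relativise (U.≐subst {t = t} {u = u} φ e d) =
    cast (sym (γ-inst φ u)) (≐subst (γ φ) (relativise e) (cast (γ-inst φ t) (relativise d)))
  relativise (U.nonempty {φ = φ} s d) =
    cast (ST.wkF-inst ∅ (γ φ))
         (⇒E (∀E (∀I-relativised (cast (γ-wkF φ) (relativise d))) ∅)
             (cast (sym (δ-inst s ∅)) (δ-∅ s)))

mainTheorem3 : (ψ : U.Sentence) → UTC₁-Ax U.⊢ ψ → TC₁b-Ax TC.⊢ γ ψ
mainTheorem3 ψ = Relativisation.relativise
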